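{- Let $G$ be a graph with $n$ vertices and $m$ edges. Let $T$ be a caterpillar with $a\geq 1$ non-leaf vertices and maximum degree $k$. Then $G$ contains at most $n\cdot\left(\frac{2m}{a}\right)^{ak}$ copies of $T$.
   Context: A caterpillar is a tree in which the non-leaf vertices form a path. A copy of $T$ in $G$ is a subgraph of $G$ isomorphic to $T$. -}

module Defs where

open import Data.Nat using (ℕ; zero; suc; _+_; _≤_; _<ᵇ_)
open import Data.Bool using (Bool; true; false; if_then_else_; _∧_)
open import Data.Fin using (Fin; toℕ; inject₁; fromℕ) renaming (zero to fzero; suc to fsuc)
open import Data.List using (List; map; allFin)
open import Data.Nat.ListAction using (sum)
open import Data.Vec using (Vec; lookup)
open import Data.Product using (Σ; ∃; _×_; _,_)
open import Data.Sum using (_⊎_)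
open import Function.Bundles using (_⇔_)
open import Function.Definitions using (Injective)
open import Relation.Binary.PropositionalEquality using (_≡_)
open import Relation.Nullary using (¬_)

record Graph (n : ℕ) : Set where
  field
    adj   : Fin n → Fin n → Bool
    sym   : ∀ u v → adj u v ≡ adj v u
    irref : ∀ v → adj v v ≡ false
open Graph public

edgeCount : ∀ {n} → Graph n → ℕ
edgeCount {n} G =
  sum (map (λ u → sum (map (λ v → if (toℕ u <ᵇ toℕ v) ∧ adj G u v then 1 else 0) (allFin n))) (allFin n))

degree : ∀ {n} → Graph n → Fin n → ℕ
degree {n} G v = sum (map (λ u → if adj G v u then 1 else 0) (allFin n))

data Walk {n : ℕ} (G : Graph n) : Fin n → Fin n → Set where
  nil  : ∀ {u} → Walk G u u
  cons : ∀ {u v w} → adj G u v ≡ true → Walk G v w → Walk G u w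

Connected : ∀ {n} → Graph n → Set
Connected {n} G = ∀ (u v : Fin n) → Walk G u v

HasCycle : ∀ {n} → Graph n → Set
HasCycle {n} G =
  Σ ℕ λ l → Σ (Vec (Fin n) (suc (suc (suc l)))) λ c →
    Injective _≡_ _≡_ (lookup c)
    × (∀ (i : Fin (suc (suc l))) → adj G (lookup c (inject₁ i)) (lookup c (fsuc i)) ≡ true)
    × adj G (lookup c (fromℕ (suc (suc l)))) (lookup c fzero) ≡ true

IsTree : ∀ {t} → Graph t → Set
IsTree {t} T = (1 ≤ t) × Connected T × ¬ HasCycle T

NonLeaf : ∀ {t} → Graph t → Fin t → Set
NonLeaf T v = ¬ (degree T v ≡ 1)

-- T is a caterpillar with exactly a non-leaf vertices: T is a tree and its non-leaf
-- vertices can be listed (without repetition) as p₀,…,p_{a-1} so that they induce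
-- the path p₀ p₁ … p_{a-1}.
IsCaterpillar : ∀ {t} → Graph t → ℕ → Set
IsCaterpillar {t} T a =
  IsTree T ×
  Σ (Vec (Fin t) a) λ p →
    Injective _≡_ _≡_ (lookup p)
    × (∀ v → NonLeaf T v ⇔ ∃ λ i → lookup p i ≡ v)
    × (∀ i j → (adj T (lookup p i) (lookup p j) ≡ true)
                 ⇔ ((suc (toℕ i) ≡ toℕ j) ⊎ (suc (toℕ j) ≡ toℕ i)))

MaxDegree : ∀ {t} → Graph t → ℕ → Set
MaxDegree T k = (∀ v → degree T v ≤ k) × ∃ λ v → degree T v ≡ k

-- A subgraph H = (S, F) of G on vertex set Fin n: S is the vertex subset, F the
-- adjacency matrix of the edge set.
Sub : ℕ → Set
Sub n = Vec Bool n × Vec (Vec Bool n) n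

IsCopy : ∀ {n t} → Graph n → Graph t → Sub n → Set
IsCopy {n} {t} G T (S , F) =
  (∀ u v → lookup (lookup F u) v ≡ true → adj G u v ≡ true)
  × (∀ u v → lookup (lookup F u) v ≡ true → (lookup S u ≡ true) × (lookup S v ≡ true))
  × Σ (Fin t → Fin n) λ φ →
      Injective _≡_ _≡_ φ
      × (∀ v → lookup S v ≡ true ⇔ ∃ λ x → φ x ≡ v)
      × (∀ x y → adj T x y ≡ lookup (lookup F (φ x)) (φ y))

-- Let p₀, …, p_{a-1} be the spine of T. Every vertex of a caterpillar is p₀ or a neighbour of a
-- spine vertex, so a copy φ of T is determined by φ(p₀) and the a tuples φ(N(pᵢ)), the neighbours
-- being listed in a fixed order; the tuple for pᵢ contains φ(p_{i+1}) at a position fixed by T.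
-- If φ(pᵢ) has degree dᵢ in G there are at most dᵢ^{deg pᵢ} ≤ dᵢ^k choices for its tuple, and the
-- φ(pᵢ) are distinct, so d₀ + ⋯ + d_{a-1} ≤ 2m. Hence from a fixed φ(p₀) there are at most
-- max {∏ dᵢ^k : Σ dᵢ ≤ 2m} = (2m/a)^{ak} codes, by induction on a with the two-term AM-GM
-- inequality (r+1)^{r+1} d y^r ≤ r^r (d+y)^{r+1}; the n choices of φ(p₀) give the bound.

module Submission where

open import Defs renaming (sym to adj-sym)
open import Data.Nat hiding (_≟_)
import Data.Nat as ℕ
open import Data.Nat.Properties hiding (_≟_)
open import Data.Nat.ListAction using (sum)
open import Data.Nat.ListAction.Properties using (sum-++; sum-↭)
open import Data.Nat.Tactic.RingSolver using (solve-∀)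
open import Algebra.Properties.CommutativeSemigroup *-commutativeSemigroup
  using (x∙yz≈y∙xz) renaming (interchange to *-interchange)
open import Algebra.Properties.CommutativeSemigroup +-commutativeSemigroup
  using () renaming (interchange to +-interchange)
open import Data.Bool using (Bool; true; false; if_then_else_; _∧_)
open import Data.Bool.Properties using (T-≡)
open import Data.Empty using (⊥; ⊥-elim)
open import Data.Fin using (Fin; toℕ; inject₁; _≟_) renaming (zero to fzero; suc to fsuc)
open import Data.Fin.Properties using (toℕ-injective; toℕ-inject₁)
open import Data.List using (List; []; _∷_; [_]; _++_; map; length; concatMap; tabulate; allFin; filterᵇ)
open import Data.List.Properties
  using (length-++; length-map; length-tabulate; map-cong; map-++; ∷-injectiveˡ; ∷-injectiveʳ)
open import Data.List.Membership.Propositional using (_∈_; lose; find)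
open import Data.List.Membership.Propositional.Properties
  using (∈-map⁺; ∈-concatMap⁺; ∈-∃++; ∈-allFin; ∈-tabulate⁺; ∈-filter⁺; ∈-filter⁻)
open import Data.List.Relation.Binary.Subset.Propositional using (_⊆_)
open import Data.List.Relation.Binary.Permutation.Propositional using (_↭_; ↭-refl; ↭-sym; ↭-trans; prep)
open import Data.List.Relation.Binary.Permutation.Propositional.Properties using (shift; ∈-resp-↭; ↭-length)
import Data.List.Relation.Binary.Permutation.Propositional.Properties as ↭
open import Data.List.Relation.Unary.Any using (Any; here; there)
open import Data.List.Relation.Unary.All using (All; []; _∷_; reduce)
import Data.List.Relation.Unary.All as All
import Data.List.Relation.Unary.All.Properties as All
open import Data.List.Relation.Unary.AllPairs using ([]; _∷_)
open import Data.List.Relation.Unary.Linked using (Linked; [-]; _∷_)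
open import Data.List.Relation.Unary.Unique.Propositional using (Unique)
open import Data.List.Relation.Unary.Unique.Propositional.Properties using (tabulate⁺)
import Data.List.Relation.Unary.Unique.Propositional.Properties as Unique
open import Data.Vec using (Vec; lookup)
open import Data.Vec.Properties using (tabulate∘lookup; tabulate-cong)
open import Data.Product using (∃; _×_; _,_; proj₁; proj₂)
open import Data.Sum using (_⊎_; inj₁; inj₂)
open import Function using (_∘_)
open import Function.Bundles using (_⇔_; Equivalence)
open import Function.Definitions using (Injective)
open import Relation.Binary.Definitions using (DecidableEquality)
open import Relation.Binary.PropositionalEquality hiding ([_])
open import Relation.Nullary using (does; yes; no; contradiction)
open import Relation.Nullary.Decidable using (T?)
open import Relation.Nullary.Reflects using (ofʸ; ofⁿ)

^-distribʳ-* : ∀ m n o → (n * o) ^ m ≡ n ^ m * o ^ m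
^-distribʳ-* zero    n o = refl
^-distribʳ-* (suc m) n o = begin
  n * o * (n * o) ^ m     ≡⟨ cong (n * o *_) (^-distribʳ-* m n o) ⟩
  n * o * (n ^ m * o ^ m) ≡⟨ *-interchange n o (n ^ m) (o ^ m) ⟩
  n * n ^ m * (o * o ^ m) ∎
  where open ≡-Reasoning

*-+-rearrangement : ∀ {a b c d} → a ≤ b → c ≤ d → a * d + b * c ≤ a * c + b * d
*-+-rearrangement {a} {c = c} a≤b c≤d with m≤n⇒∃[o]m+o≡n a≤b | m≤n⇒∃[o]m+o≡n c≤d
... | p , refl | q , refl = subst (a * (c + q) + (a + p) * c ≤_) (expand a c p q) (m≤m+n _ (p * q))
  where
  expand : ∀ a c p q → a * (c + q) + (a + p) * c + p * q ≡ a * c + (a + p) * (c + q)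
  expand = solve-∀

*-^-rearrangement : ∀ j u w → u * w ^ j + w * u ^ j ≤ u * u ^ j + w * w ^ j
*-^-rearrangement j u w with ≤-total u w
... | inj₁ u≤w = *-+-rearrangement u≤w (^-monoˡ-≤ j u≤w)
... | inj₂ w≤u = subst₂ _≤_ (+-comm (w * u ^ j) (u * w ^ j)) (+-comm (w * w ^ j) (u * u ^ j))
                         (*-+-rearrangement w≤u (^-monoˡ-≤ j w≤u))

weighted-am-gm : ∀ j u w → suc j * u * w ^ j ≤ u ^ suc j + j * w ^ suc j
weighted-am-gm zero    u w = ≤-reflexive (base u w)
  where
  base : ∀ u w → 1 * u * 1 ≡ u * 1 + 0 * (w * 1)
  base = solve-∀
weighted-am-gm (suc j) u w = begin
  suc (suc j) * u * (w * Y)             ≡⟨ split j u w Y ⟩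
  u * (w * Y) + (suc j * u * Y) * w     ≤⟨ +-monoʳ-≤ (u * (w * Y)) (*-monoˡ-≤ w (weighted-am-gm j u w)) ⟩
  u * (w * Y) + (X + j * (w * Y)) * w   ≡⟨ regroup j u w X Y ⟩
  u * (w * Y) + w * X + j * (w * (w * Y)) ≤⟨ +-monoˡ-≤ _ (*-^-rearrangement (suc j) u w) ⟩
  u * X + w * (w * Y) + j * (w * (w * Y)) ≡⟨ collect j u w X Y ⟩
  u * X + suc j * (w * (w * Y))         ∎
  where
  open ≤-Reasoning
  X = u ^ suc j
  Y = w ^ j
  split : ∀ j u w Y → suc (suc j) * u * (w * Y) ≡ u * (w * Y) + (suc j * u * Y) * w
  split = solve-∀
  regroup : ∀ j u w X Y → u * (w * Y) + (X + j * (w * Y)) * w ≡ u * (w * Y) + w * X + j * (w * (w * Y))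
  regroup = solve-∀
  collect : ∀ j u w X Y → u * X + w * (w * Y) + j * (w * (w * Y)) ≡ u * X + suc j * (w * (w * Y))
  collect = solve-∀

am-gm : ∀ j x y → suc j ^ suc j * x * y ^ j ≤ j ^ j * (x + y) ^ suc j
am-gm zero    x y = subst₂ _≤_ (left x) (right x y) (m≤m+n x y)
  where
  left : ∀ x → x ≡ 1 * 1 * x * 1
  left = solve-∀
  right : ∀ x y → x + y ≡ 1 * ((x + y) * 1)
  right = solve-∀
am-gm (suc i) x y = *-cancelˡ-≤ j (+-cancelʳ-≤ C _ _ (subst₂ _≤_ left right weighted))
  where
  j = suc i
  B = suc j ^ j
  C = j * (suc j * B) * (y * y ^ j)
  weighted : suc j * (j * (x + y)) * (suc j * y) ^ j ≤ (j * (x + y)) ^ suc j + j * (suc j * y) ^ suc j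
  weighted = weighted-am-gm j (j * (x + y)) (suc j * y)
  left : suc j * (j * (x + y)) * (suc j * y) ^ j ≡ j * (suc j * B * x * y ^ j) + C
  left = trans (cong (suc j * (j * (x + y)) *_) (^-distribʳ-* j (suc j) y)) (expand j x y B (y ^ j))
    where
    expand : ∀ j x y B Y → suc j * (j * (x + y)) * (B * Y) ≡ j * (suc j * B * x * Y) + j * (suc j * B) * (y * Y)
    expand = solve-∀
  right : (j * (x + y)) ^ suc j + j * (suc j * y) ^ suc j ≡ j * (j ^ j * (x + y) ^ suc j) + C
  right = cong₂ _+_ (trans (^-distribʳ-* (suc j) j (x + y)) (*-assoc j (j ^ j) _))
                    (trans (cong (j *_) (^-distribʳ-* (suc j) (suc j) y)) (sym (*-assoc j (suc j * B) (y * y ^ j))))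

n^n≢0 : ∀ n → NonZero (n ^ n)
n^n≢0 zero    = _
n^n≢0 (suc n) = m^n≢0 (suc n) (suc n)

am-gm-^ : ∀ r k d y → (suc r ^ suc r) ^ k * (d ^ k * (y ^ r) ^ k) ≤ (r ^ r) ^ k * ((d + y) ^ suc r) ^ k
am-gm-^ r k d y = begin
  (suc r ^ suc r) ^ k * (d ^ k * (y ^ r) ^ k) ≡⟨ cong ((suc r ^ suc r) ^ k *_) (^-distribʳ-* k d (y ^ r)) ⟨
  (suc r ^ suc r) ^ k * (d * y ^ r) ^ k       ≡⟨ ^-distribʳ-* k (suc r ^ suc r) (d * y ^ r) ⟨
  (suc r ^ suc r * (d * y ^ r)) ^ k           ≡⟨ cong (_^ k) (*-assoc (suc r ^ suc r) d (y ^ r)) ⟨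
  (suc r ^ suc r * d * y ^ r) ^ k             ≤⟨ ^-monoˡ-≤ k (am-gm r d y) ⟩
  (r ^ r * (d + y) ^ suc r) ^ k               ≡⟨ ^-distribʳ-* k (r ^ r) ((d + y) ^ suc r) ⟩
  (r ^ r) ^ k * ((d + y) ^ suc r) ^ k         ∎
  where open ≤-Reasoning

private
  variable
    A B : Set

tuples : ℕ → List A → List (List A)
tuples zero    xs = [ [] ]
tuples (suc e) xs = concatMap (λ x → map (x ∷_) (tuples e xs)) xs

length-concatMap : (f : A → List B) (xs : List A) → length (concatMap f xs) ≡ sum (map (length ∘ f) xs)
length-concatMap f []       = refl
length-concatMap f (x ∷ xs) = trans (length-++ (f x)) (cong (length (f x) +_) (length-concatMap f xs))

sum-map-const : (xs : List A) (c : ℕ) → sum (map (λ _ → c) xs) ≡ length xs * c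
sum-map-const []       c = refl
sum-map-const (x ∷ xs) c = cong (c +_) (sum-map-const xs c)

length-tuples : ∀ e (xs : List A) → length (tuples e xs) ≡ length xs ^ e
length-tuples zero    xs = refl
length-tuples (suc e) xs = begin
  length (concatMap (λ x → map (x ∷_) (tuples e xs)) xs)     ≡⟨ length-concatMap _ xs ⟩
  sum (map (λ x → length (map (x ∷_) (tuples e xs))) xs)   ≡⟨ cong sum (map-cong each xs) ⟩
  sum (map (λ _ → length xs ^ e) xs)                        ≡⟨ sum-map-const xs _ ⟩
  length xs * length xs ^ e                                 ∎
  where
  open ≡-Reasoning
  each : ∀ x → length (map (x ∷_) (tuples e xs)) ≡ length xs ^ e
  each x = trans (length-map (x ∷_) (tuples e xs)) (length-tuples e xs)

∈-tuples : ∀ {xs : List A} {ws} → All (_∈ xs) ws → ws ∈ tuples (length ws) xs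
∈-tuples []                        = here refl
∈-tuples (_∷_ {w} w∈xs ws⊆xs) = ∈-concatMap⁺ _ (lose w∈xs (∈-map⁺ (w ∷_) (∈-tuples ws⊆xs)))

*-sum-map-≤ : ∀ (f : A → ℕ) {c b} (xs : List A) → (∀ x → c * f x ≤ b) →
              c * sum (map f xs) ≤ length xs * b
*-sum-map-≤ f {c} []       bound = ≤-reflexive (*-zeroʳ c)
*-sum-map-≤ f {c} {b} (x ∷ xs) bound = subst (_≤ b + length xs * b) (sym (*-distribˡ-+ c (f x) _))
  (+-mono-≤ (bound x) (*-sum-map-≤ f {c} xs bound))

unique-⊆⇒++↭ : ∀ {xs ys : List A} → Unique xs → xs ⊆ ys → ∃ λ zs → xs ++ zs ↭ ys
unique-⊆⇒++↭ {xs = []}    {ys} _            _    = ys , ↭-refl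
unique-⊆⇒++↭ {xs = x ∷ xs}     (x∉xs ∷ !xs) x∷xs⊆ys with ∈-∃++ (x∷xs⊆ys (here refl))
... | ys₁ , ys₂ , refl with unique-⊆⇒++↭ !xs xs⊆ys₁ys₂
  where
  xs⊆ys₁ys₂ : xs ⊆ ys₁ ++ ys₂
  xs⊆ys₁ys₂ {z} z∈xs with ∈-resp-↭ (shift x ys₁ ys₂) (x∷xs⊆ys (there z∈xs))
  ... | here refl = ⊥-elim (All.lookup x∉xs z∈xs refl)
  ... | there z∈ys₁ys₂ = z∈ys₁ys₂
... | zs , xs++zs↭ = zs , ↭-trans (prep x xs++zs↭) (↭-sym (shift x ys₁ ys₂))

unique-⊆⇒length≤ : ∀ {xs ys : List A} → Unique xs → xs ⊆ ys → length xs ≤ length ys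
unique-⊆⇒length≤ {xs = xs} {ys} !xs xs⊆ys with unique-⊆⇒++↭ !xs xs⊆ys
... | zs , σ = begin
  length xs               ≤⟨ m≤m+n _ _ ⟩
  length xs + length zs   ≡⟨ sym (length-++ xs) ⟩
  length (xs ++ zs)       ≡⟨ ↭-length σ ⟩
  length ys               ∎
  where open ≤-Reasoning

unique-⊆⇒sum≤ : ∀ (f : A → ℕ) {xs ys} → Unique xs → xs ⊆ ys → sum (map f xs) ≤ sum (map f ys)
unique-⊆⇒sum≤ f {xs} {ys} !xs xs⊆ys with unique-⊆⇒++↭ !xs xs⊆ys
... | zs , σ = begin
  sum (map f xs)                    ≤⟨ m≤m+n _ _ ⟩
  sum (map f xs) + sum (map f zs)   ≡⟨ sym (sum-++ (map f xs) (map f zs)) ⟩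
  sum (map f xs ++ map f zs)        ≡⟨ cong sum (sym (map-++ f xs zs)) ⟩
  sum (map f (xs ++ zs))            ≡⟨ sum-↭ (↭.map⁺ f σ) ⟩
  sum (map f ys)                    ∎
  where open ≤-Reasoning

module _ {P : A → Set} (code : ∀ {x} → P x → B)
         (code-injective : ∀ {x y} (px : P x) (py : P y) → code px ≡ code py → x ≡ y) where

  private
    length-reduce : ∀ {xs} (pxs : All P xs) → length (reduce code pxs) ≡ length xs
    length-reduce []         = refl
    length-reduce (_ ∷ pxs) = cong suc (length-reduce pxs)

    reduce-≢ : ∀ {x xs} (px : P x) (pxs : All P xs) → All (x ≢_) xs → All (code px ≢_) (reduce code pxs)
    reduce-≢ px []          []           = []
    reduce-≢ px (py ∷ pxs) (x≢y ∷ x≢ys) = (x≢y ∘ code-injective px py) ∷ reduce-≢ px pxs x≢ys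

    unique-reduce : ∀ {xs} → Unique xs → (pxs : All P xs) → Unique (reduce code pxs)
    unique-reduce []            []          = []
    unique-reduce (x≢xs ∷ !xs) (px ∷ pxs) = reduce-≢ px pxs x≢xs ∷ unique-reduce !xs pxs

  encoding⇒length≤ : ∀ {xs ys} → Unique xs → All P xs → (∀ {x} (px : P x) → code px ∈ ys) →
                     length xs ≤ length ys
  encoding⇒length≤ {xs} {ys} !xs pxs code∈ys = subst (_≤ length ys) (length-reduce pxs)
    (unique-⊆⇒length≤ (unique-reduce !xs pxs) (reduce-⊆ pxs))
    where
    reduce-⊆ : ∀ {zs} (pzs : All P zs) → reduce code pzs ⊆ ys
    reduce-⊆ (pz ∷ pzs) (here refl) = code∈ys pz
    reduce-⊆ (pz ∷ pzs) (there c∈) = reduce-⊆ pzs c∈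

nth : List A → ℕ → A → A
nth []       i       d = d
nth (x ∷ xs) zero    d = x
nth (x ∷ xs) (suc i) d = nth xs i d

module _ (_≟_ : DecidableEquality A) where

  indexOf : A → List A → ℕ
  indexOf x []       = 0
  indexOf x (y ∷ ys) = if does (x ≟ y) then 0 else suc (indexOf x ys)

  nth-map-indexOf : ∀ (f : A → B) {x xs} d → x ∈ xs → nth (map f xs) (indexOf x xs) d ≡ f x
  nth-map-indexOf f {x} {y ∷ ys} d x∈ with x ≟ y
  ... | yes refl = refl
  nth-map-indexOf f d (here refl) | no x≢x = ⊥-elim (x≢x refl)
  nth-map-indexOf f d (there x∈)  | no _   = nth-map-indexOf f d x∈

map-≡⇒∈-≡ : ∀ (f g : A → B) {x xs} → map f xs ≡ map g xs → x ∈ xs → f x ≡ g x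
map-≡⇒∈-≡ f g {xs = y ∷ ys} fxs≡gxs (here refl) = ∷-injectiveˡ fxs≡gxs
map-≡⇒∈-≡ f g {xs = y ∷ ys} fxs≡gxs (there x∈) = map-≡⇒∈-≡ f g (∷-injectiveʳ fxs≡gxs) x∈

linked-tabulate : ∀ {R : A → A → Set} {m} (f : Fin (suc m) → A) →
                  (∀ i → R (f (inject₁ i)) (f (fsuc i))) → Linked R (tabulate f)
linked-tabulate {m = zero}  f R-step = [-]
linked-tabulate {m = suc m} f R-step = R-step fzero ∷ linked-tabulate (f ∘ fsuc) (R-step ∘ fsuc)

length-filterᵇ : (p : A → Bool) (xs : List A) →
                 length (filterᵇ p xs) ≡ sum (map (λ x → if p x then 1 else 0) xs)
length-filterᵇ p []       = refl
length-filterᵇ p (x ∷ xs) with p x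
... | true  = cong suc (length-filterᵇ p xs)
... | false = length-filterᵇ p xs

sum-map-+ : (f g : A → ℕ) (xs : List A) → sum (map (λ x → f x + g x) xs) ≡ sum (map f xs) + sum (map g xs)
sum-map-+ f g []       = refl
sum-map-+ f g (x ∷ xs) = trans (cong (f x + g x +_) (sum-map-+ f g xs)) (+-interchange (f x) (g x) _ _)

sum-map-swap : ∀ {B : Set} (f : A → B → ℕ) (xs : List A) (ys : List B) →
  sum (map (λ x → sum (map (f x) ys)) xs) ≡ sum (map (λ y → sum (map (λ x → f x y) xs)) ys)
sum-map-swap f []       ys = sym (trans (sum-map-const ys 0) (*-zeroʳ (length ys)))
sum-map-swap f (x ∷ xs) ys = trans (cong (sum (map (f x) ys) +_) (sum-map-swap f xs ys))
  (sym (sum-map-+ (f x) (λ y → sum (map (λ x → f x y) xs)) ys))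

≡true⇔⇒≡ : ∀ {b c : Bool} → (b ≡ true → c ≡ true) → (c ≡ true → b ≡ true) → b ≡ c
≡true⇔⇒≡ {true}  {true}  _   _   = refl
≡true⇔⇒≡ {true}  {false} b⇒c _   = sym (b⇒c refl)
≡true⇔⇒≡ {false} {true}  _   c⇒b = c⇒b refl
≡true⇔⇒≡ {false} {false} _   _   = refl

lookup-ext : ∀ {A : Set} {m} {xs ys : Vec A m} → (∀ i → lookup xs i ≡ lookup ys i) → xs ≡ ys
lookup-ext {xs = xs} {ys} eq = trans (sym (tabulate∘lookup xs)) (trans (tabulate-cong eq) (tabulate∘lookup ys))

module _ {n : ℕ} (G : Graph n) where

  nbrs : Fin n → List (Fin n)
  nbrs v = filterᵇ (adj G v) (allFin n)

  degree≡length-nbrs : ∀ v → degree G v ≡ length (nbrs v)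
  degree≡length-nbrs v = sym (length-filterᵇ (adj G v) (allFin n))

  ∈-nbrs⁺ : ∀ {v u} → adj G v u ≡ true → u ∈ nbrs v
  ∈-nbrs⁺ {v} {u} v~u = ∈-filter⁺ (λ u → T? (adj G v u)) (∈-allFin u) (Equivalence.from T-≡ v~u)

  ∈-nbrs⁻ : ∀ {v u} → u ∈ nbrs v → adj G v u ≡ true
  ∈-nbrs⁻ {v} u∈ = Equivalence.to T-≡ (proj₂ (∈-filter⁻ (λ u → T? (adj G v u)) {xs = allFin n} u∈))

  handshake : sum (map (degree G) (allFin n)) ≡ 2 * edgeCount G
  handshake = begin
    sum (map (λ u → sum (map (λ v → χ (adj G u v)) (allFin n))) (allFin n))
      ≡⟨ cong sum (map-cong row (allFin n)) ⟩
    sum (map (λ u → sum (map (E u) (allFin n)) + sum (map (λ v → E v u) (allFin n))) (allFin n))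
      ≡⟨ sum-map-+ _ _ (allFin n) ⟩
    edgeCount G + sum (map (λ u → sum (map (λ v → E v u) (allFin n))) (allFin n))
      ≡⟨ cong (edgeCount G +_) (sym (sum-map-swap E (allFin n) (allFin n))) ⟩
    edgeCount G + edgeCount G
      ≡⟨ cong (edgeCount G +_) (sym (+-identityʳ _)) ⟩
    2 * edgeCount G ∎
    where
    open ≡-Reasoning
    χ : Bool → ℕ
    χ b = if b then 1 else 0
    E : Fin n → Fin n → ℕ
    E u v = χ ((toℕ u <ᵇ toℕ v) ∧ adj G u v)
    split : ∀ u v → χ (adj G u v) ≡ E u v + E v u
    split u v with toℕ u <ᵇ toℕ v | <ᵇ-reflects-< (toℕ u) (toℕ v)
                 | toℕ v <ᵇ toℕ u | <ᵇ-reflects-< (toℕ v) (toℕ u)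
    ... | true  | ofʸ u<v | true  | ofʸ v<u = ⊥-elim (<-asym u<v v<u)
    ... | true  | _       | false | _       = sym (+-identityʳ _)
    ... | false | _       | true  | _       = cong χ (adj-sym G u v)
    ... | false | ofⁿ u≮v | false | ofⁿ v≮u with toℕ-injective (≤-antisym (≮⇒≥ v≮u) (≮⇒≥ u≮v))
    ...   | refl = cong χ (irref G u)
    row : ∀ u → sum (map (λ v → χ (adj G u v)) (allFin n))
              ≡ sum (map (E u) (allFin n)) + sum (map (λ v → E v u) (allFin n))
    row u = trans (cong sum (map-cong (split u) (allFin n))) (sum-map-+ (E u) (λ v → E v u) (allFin n))

  neighbour⇒0<degree : ∀ {v u} → adj G v u ≡ true → 0 < degree G v
  neighbour⇒0<degree {v} v~u = subst (1 ≤_) (sym (degree≡length-nbrs v))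
    (unique-⊆⇒length≤ ([] ∷ []) λ { (here refl) → ∈-nbrs⁺ v~u })

  0<degree⇒neighbour : ∀ {v} → 0 < degree G v → ∃ λ u → adj G v u ≡ true
  0<degree⇒neighbour {v} 0<d with nbrs v in eq
  ... | u ∷ _ = u , ∈-nbrs⁻ (subst (u ∈_) (sym eq) (here refl))
  ... | []    = ⊥-elim (<-irrefl (sym (trans (degree≡length-nbrs v) (cong length eq))) 0<d)

  leaf-neighbour-unique : ∀ {v u w} → degree G v ≡ 1 → adj G v u ≡ true → adj G v w ≡ true → u ≡ w
  leaf-neighbour-unique {v} {u} {w} leaf v~u v~w with u ≟ w
  ... | yes u≡w = u≡w
  ... | no  u≢w = ⊥-elim (<-irrefl (sym leaf) (subst (2 ≤_) (sym (degree≡length-nbrs v))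
          (unique-⊆⇒length≤ ((u≢w ∷ []) ∷ [] ∷ [])
             λ { (here refl) → ∈-nbrs⁺ v~u ; (there (here refl)) → ∈-nbrs⁺ v~w })))

  leaf-edge-closed : ∀ {y z} → degree G y ≡ 1 → degree G z ≡ 1 → adj G y z ≡ true →
                     ∀ {u w} → Walk G u w → u ≡ y ⊎ u ≡ z → w ≡ y ⊎ w ≡ z
  leaf-edge-closed ly lz y~z nil         u∈yz       = u∈yz
  leaf-edge-closed ly lz y~z (cons e wk) (inj₁ refl) =
    leaf-edge-closed ly lz y~z wk (inj₂ (leaf-neighbour-unique ly e y~z))
  leaf-edge-closed {y} {z} ly lz y~z (cons e wk) (inj₂ refl) =
    leaf-edge-closed ly lz y~z wk (inj₁ (leaf-neighbour-unique lz e (trans (adj-sym G z y) y~z)))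

  -- A code for the shape (e₁ , j₁) ∷ … from v is a list of tuples: the i-th is an eᵢ-tuple of
  -- neighbours of the current vertex, the next vertex is its jᵢ-th entry, and the degrees of the
  -- vertices visited must add up to at most R.
  codes : List (ℕ × ℕ) → Fin n → ℕ → List (List (List (Fin n)))
  codes []             v R = [ [] ]
  codes ((e , j) ∷ sh) v R =
    if degree G v ≤ᵇ R
    then concatMap (λ ws → map (ws ∷_) (codes sh (nth ws j v) (R ∸ degree G v))) (tuples e (nbrs v))
    else []

  ∈-codes-∷ : ∀ {e j sh v R ws c} → degree G v ≤ R → ws ∈ tuples e (nbrs v) →
              c ∈ codes sh (nth ws j v) (R ∸ degree G v) → ws ∷ c ∈ codes ((e , j) ∷ sh) v R
  ∈-codes-∷ {v = v} {R} d≤R ws∈ c∈ with degree G v ≤ᵇ R | ≤ᵇ-reflects-≤ (degree G v) R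
  ... | true  | _        = ∈-concatMap⁺ _ (lose ws∈ (∈-map⁺ _ c∈))
  ... | false | ofⁿ d≰R = contradiction d≤R d≰R

  length-codes : ∀ k sh v R → All (λ (e , _) → ∀ d → d ^ e ≤ d ^ k) sh →
                 (length sh ^ length sh) ^ k * length (codes sh v R) ≤ (R ^ length sh) ^ k
  length-codes k []             v R []              = ≤-reflexive (*-identityʳ _)
  length-codes k ((e , j) ∷ sh) v R (e≼k ∷ sh≼k) with degree G v ≤ᵇ R | ≤ᵇ-reflects-≤ (degree G v) R
  ... | false | _ = subst (_≤ (R ^ suc (length sh)) ^ k) (sym (*-zeroʳ ((suc (length sh) ^ suc (length sh)) ^ k))) z≤n
  ... | true | ofʸ d≤R = *-cancelˡ-≤ K {{m^n≢0 (r ^ r) k {{n^n≢0 r}}}} (begin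
    K * (K′ * g)                   ≡⟨ x∙yz≈y∙xz K K′ g ⟩
    K′ * (K * g)                   ≤⟨ *-monoʳ-≤ K′ tail-bound ⟩
    K′ * (d ^ k * (y ^ r) ^ k)     ≤⟨ am-gm-^ r k d y ⟩
    K * ((d + y) ^ suc r) ^ k      ≡⟨ cong (λ z → K * (z ^ suc r) ^ k) (m+[n∸m]≡n d≤R) ⟩
    K * (R ^ suc r) ^ k            ∎)
    where
    open ≤-Reasoning
    r = length sh
    d = degree G v
    y = R ∸ d
    K = (r ^ r) ^ k
    K′ = (suc r ^ suc r) ^ k
    ts = tuples e (nbrs v)
    continue : List (Fin n) → List (List (List (Fin n)))
    continue ws = map (ws ∷_) (codes sh (nth ws j v) y)
    g = length (concatMap continue ts)
    #tuples≤ : length ts ≤ d ^ k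
    #tuples≤ = subst (_≤ d ^ k)
      (sym (trans (length-tuples e (nbrs v)) (cong (_^ e) (sym (degree≡length-nbrs v))))) (e≼k d)
    tail-bound : K * g ≤ d ^ k * (y ^ r) ^ k
    tail-bound = subst (λ z → K * z ≤ d ^ k * (y ^ r) ^ k) (sym (length-concatMap continue ts))
      (≤-trans (*-sum-map-≤ (λ ws → length (continue ws)) {K} ts
                  (λ ws → subst (λ z → K * z ≤ (y ^ r) ^ k) (sym (length-map (ws ∷_) (codes sh (nth ws j v) y)))
                                (length-codes k sh (nth ws j v) y sh≼k)))
               (*-monoˡ-≤ ((y ^ r) ^ k) #tuples≤))

module _ {n t : ℕ} (G : Graph n) (T : Graph t) where

  nextPosition : Fin t → List (Fin t) → ℕ
  nextPosition q []       = 0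
  nextPosition q (q′ ∷ _) = indexOf _≟_ q′ (nbrs T q)

  spineShape : List (Fin t) → List (ℕ × ℕ)
  spineShape []       = []
  spineShape (q ∷ qs) = (degree T q , nextPosition q qs) ∷ spineShape qs

  blocks : (Fin t → Fin n) → List (Fin t) → List (List (Fin n))
  blocks φ = map (λ q → map φ (nbrs T q))

  module _ (φ : Fin t → Fin n) (hom : ∀ {x y} → adj T x y ≡ true → adj G (φ x) (φ y) ≡ true) where

    nbr-images∈tuples : ∀ q → map φ (nbrs T q) ∈ tuples (degree T q) (nbrs G (φ q))
    nbr-images∈tuples q = subst (λ e → map φ (nbrs T q) ∈ tuples e (nbrs G (φ q)))
      (trans (length-map φ (nbrs T q)) (sym (degree≡length-nbrs T q)))
      (∈-tuples (All.map⁺ (All.tabulate (∈-nbrs⁺ G ∘ hom ∘ ∈-nbrs⁻ T))))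

    blocks∈codes : ∀ {q qs R} → Linked (λ x y → adj T x y ≡ true) (q ∷ qs) →
                   sum (map (degree G) (map φ (q ∷ qs))) ≤ R →
                   blocks φ (q ∷ qs) ∈ codes G (spineShape (q ∷ qs)) (φ q) R
    blocks∈codes {q} {qs} {R} linked budget =
      ∈-codes-∷ G {degree T q} {nextPosition q qs} {spineShape qs}
        (m+n≤o⇒m≤o _ budget) (nbr-images∈tuples q) (rest linked)
      where
      rest : Linked (λ x y → adj T x y ≡ true) (q ∷ qs) →
             blocks φ qs ∈ codes G (spineShape qs) (nth (map φ (nbrs T q)) (nextPosition q qs) (φ q))
                                   (R ∸ degree G (φ q))
      rest [-]                = here refl
      rest (q~q′ ∷ linked′) = subst (λ v → blocks φ qs ∈ codes G (spineShape qs) v (R ∸ degree G (φ q)))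
        (sym (nth-map-indexOf _≟_ φ (φ q) (∈-nbrs⁺ T q~q′)))
        (blocks∈codes linked′ (m+n≤o⇒m≤o∸n _ (subst (_≤ R) (+-comm (degree G (φ q)) _) budget)))

  spineShape-arity : ∀ {k} → (∀ q d → d ^ degree T q ≤ d ^ k) →
                     ∀ qs → All (λ (e , _) → ∀ d → d ^ e ≤ d ^ k) (spineShape qs)
  spineShape-arity arity []       = All.[]
  spineShape-arity {k} arity (q ∷ qs) = arity q All.∷ spineShape-arity {k} arity qs

  length-spineShape : ∀ qs → length (spineShape qs) ≡ length qs
  length-spineShape []       = refl
  length-spineShape (q ∷ qs) = cong suc (length-spineShape qs)

module _ {t : ℕ} {T : Graph t} (connected : Connected T) {k : ℕ} (maxDegree : MaxDegree T k) where

  isolated⇒maxDegree≡0 : ∀ v → degree T v ≡ 0 → k ≡ 0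
  isolated⇒maxDegree≡0 v isolated with proj₂ maxDegree
  ... | w , deg-w≡k with connected v w
  ...   | nil       = trans (sym deg-w≡k) isolated
  ...   | cons v~ _ = ⊥-elim (<-irrefl (sym isolated) (neighbour⇒0<degree T v~))

  ^degree≤^maxDegree : ∀ v d → d ^ degree T v ≤ d ^ k
  ^degree≤^maxDegree v (suc d) = ^-monoʳ-≤ (suc d) {degree T v} {k} (proj₁ maxDegree v)
  ^degree≤^maxDegree v zero with degree T v in deg-v
  ... | suc _ = z≤n
  ... | zero  rewrite isolated⇒maxDegree≡0 v deg-v = ≤-refl

module Spine {t a : ℕ} {T : Graph t} (tree : IsTree T) (p : Vec (Fin t) (suc a))
  (nonleaf⇔spine : ∀ v → NonLeaf T v ⇔ ∃ λ i → lookup p i ≡ v)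
  (spine-adj : ∀ i j → (adj T (lookup p i) (lookup p j) ≡ true)
                        ⇔ ((suc (toℕ i) ≡ toℕ j) ⊎ (suc (toℕ j) ≡ toℕ i)))
  where

  spine : List (Fin t)
  spine = tabulate (lookup p)

  spine-step : ∀ i → adj T (lookup p (inject₁ i)) (lookup p (fsuc i)) ≡ true
  spine-step i = Equivalence.from (spine-adj (inject₁ i) (fsuc i)) (inj₁ (cong suc (toℕ-inject₁ i)))

  spine-linked : Linked (λ x y → adj T x y ≡ true) spine
  spine-linked = linked-tabulate (lookup p) spine-step

  spine-dominating : ∀ y → y ≡ lookup p fzero ⊎ Any (λ q → y ∈ nbrs T q) spine
  spine-dominating y with degree T y ℕ.≟ 1
  ... | no nonleaf = nonleaf-case y nonleaf
    where
    nonleaf-case : ∀ y → NonLeaf T y → y ≡ lookup p fzero ⊎ Any (λ q → y ∈ nbrs T q) spine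
    nonleaf-case y nonleaf with Equivalence.to (nonleaf⇔spine y) nonleaf
    ... | fzero  , refl = inj₁ refl
    ... | fsuc i , refl = inj₂ (lose (∈-tabulate⁺ {f = lookup p} (inject₁ i)) (∈-nbrs⁺ T (spine-step i)))
  ... | yes leaf with 0<degree⇒neighbour T (≤-reflexive (sym leaf))
  ...   | z , y~z with degree T z ℕ.≟ 1
  ...     | no z-nonleaf with Equivalence.to (nonleaf⇔spine z) z-nonleaf
  ...       | i , refl =
    inj₂ (lose (∈-tabulate⁺ {f = lookup p} i) (∈-nbrs⁺ T (trans (adj-sym T (lookup p i) y) y~z)))
  spine-dominating y | yes leaf | z , y~z | yes z-leaf =
    ⊥-elim (head-not-leaf (leaf-edge-closed T leaf z-leaf y~z (proj₁ (proj₂ tree) y (lookup p fzero)) (inj₁ refl)))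
    where
    head-not-leaf : lookup p fzero ≡ y ⊎ lookup p fzero ≡ z → ⊥
    head-not-leaf (inj₁ refl) = Equivalence.from (nonleaf⇔spine y) (fzero , refl) leaf
    head-not-leaf (inj₂ refl) = Equivalence.from (nonleaf⇔spine z) (fzero , refl) z-leaf

module Copies {n t : ℕ} (G : Graph n) (T : Graph t) where

  embedding : ∀ s → IsCopy G T s → Fin t → Fin n
  embedding _ (_ , _ , φ , _) = φ

  embedding-injective : ∀ s (c : IsCopy G T s) → Injective _≡_ _≡_ (embedding s c)
  embedding-injective _ (_ , _ , _ , φ-injective , _) = φ-injective

  embedding-hom : ∀ s (c : IsCopy G T s) {x y} →
                  adj T x y ≡ true → adj G (embedding s c x) (embedding s c y) ≡ true
  embedding-hom _ (F⊆G , _ , φ , _ , _ , T≡F) {x} {y} x~y = F⊆G (φ x) (φ y) (trans (sym (T≡F x y)) x~y)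

  private
    vertices⊆ : ∀ S F S′ F′ (c : IsCopy G T (S , F)) (c′ : IsCopy G T (S′ , F′)) →
                (∀ x → embedding (S , F) c x ≡ embedding (S′ , F′) c′ x) →
                ∀ v → lookup S v ≡ true → lookup S′ v ≡ true
    vertices⊆ S F S′ F′ (_ , _ , φ , _ , S≡imφ , _) (_ , _ , φ′ , _ , S′≡imφ′ , _) φ≗φ′ v v∈S
      with Equivalence.to (S≡imφ v) v∈S
    ... | x , refl = Equivalence.from (S′≡imφ′ (φ x)) (x , sym (φ≗φ′ x))

    edges⊆ : ∀ S F S′ F′ (c : IsCopy G T (S , F)) (c′ : IsCopy G T (S′ , F′)) →
             (∀ x → embedding (S , F) c x ≡ embedding (S′ , F′) c′ x) →
             ∀ u v → lookup (lookup F u) v ≡ true → lookup (lookup F′ u) v ≡ true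
    edges⊆ S F S′ F′ (_ , F⊆S , φ , _ , S≡imφ , T≡F) (_ , _ , φ′ , _ , _ , T≡F′) φ≗φ′ u v uv∈F
      with Equivalence.to (S≡imφ u) (proj₁ (F⊆S u v uv∈F)) | Equivalence.to (S≡imφ v) (proj₂ (F⊆S u v uv∈F))
    ... | x , refl | y , refl = subst₂ (λ u v → lookup (lookup F′ u) v ≡ true) (sym (φ≗φ′ x)) (sym (φ≗φ′ y))
                                  (trans (sym (T≡F′ x y)) (trans (T≡F x y) uv∈F))

  copy-unique : ∀ s s′ (c : IsCopy G T s) (c′ : IsCopy G T s′) →
                (∀ x → embedding s c x ≡ embedding s′ c′ x) → s ≡ s′
  copy-unique (S , F) (S′ , F′) c c′ φ≗φ′ = cong₂ _,_
    (lookup-ext λ v → ≡true⇔⇒≡ (vertices⊆ S F S′ F′ c c′ φ≗φ′ v) (vertices⊆ S′ F′ S F c′ c φ′≗φ v))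
    (lookup-ext λ u → lookup-ext λ v →
      ≡true⇔⇒≡ (edges⊆ S F S′ F′ c c′ φ≗φ′ u v) (edges⊆ S′ F′ S F c′ c φ′≗φ u v))
    where
    φ′≗φ : ∀ x → embedding (S′ , F′) c′ x ≡ embedding (S , F) c x
    φ′≗φ x = sym (φ≗φ′ x)

module Encoding {n t a k : ℕ} (G : Graph n) {T : Graph t} (tree : IsTree T) (p : Vec (Fin t) (suc a))
  (p-injective : Injective _≡_ _≡_ (lookup p))
  (nonleaf⇔spine : ∀ v → NonLeaf T v ⇔ ∃ λ i → lookup p i ≡ v)
  (spine-adj : ∀ i j → (adj T (lookup p i) (lookup p j) ≡ true)
                        ⇔ ((suc (toℕ i) ≡ toℕ j) ⊎ (suc (toℕ j) ≡ toℕ i)))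
  (maxDegree : MaxDegree T k) where

  open Spine tree p nonleaf⇔spine spine-adj
  open Copies G T

  M : ℕ
  M = 2 * edgeCount G

  allCodes : List (Fin n × List (List (Fin n)))
  allCodes = concatMap (λ v → map (v ,_) (codes G (spineShape G T spine) v M)) (allFin n)

  code : ∀ s → IsCopy G T s → Fin n × List (List (Fin n))
  code s c = embedding s c (lookup p fzero) , blocks G T (embedding s c) spine

  code∈allCodes : ∀ s (c : IsCopy G T s) → code s c ∈ allCodes
  code∈allCodes s c = ∈-concatMap⁺ _ (lose (∈-allFin (φ (lookup p fzero)))
    (∈-map⁺ _ (blocks∈codes G T φ (embedding-hom s c) spine-linked degrees≤M)))
    where
    φ = embedding s c
    degrees≤M : sum (map (degree G) (map φ spine)) ≤ M
    degrees≤M = subst (sum (map (degree G) (map φ spine)) ≤_) (handshake G)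
      (unique-⊆⇒sum≤ (degree G) (Unique.map⁺ (embedding-injective s c) (tabulate⁺ p-injective))
                     (λ {v} _ → ∈-allFin v))

  code-injective : ∀ {s s′} (c : IsCopy G T s) (c′ : IsCopy G T s′) → code s c ≡ code s′ c′ → s ≡ s′
  code-injective {s} {s′} c c′ codes≡ = copy-unique s s′ c c′ φ≗φ′
    where
    φ≗φ′ : ∀ y → embedding s c y ≡ embedding s′ c′ y
    φ≗φ′ y with spine-dominating y
    ... | inj₁ refl = cong proj₁ codes≡
    ... | inj₂ y∈N[spine] with find y∈N[spine]
    ...   | q , q∈spine , y∈N[q] =
      map-≡⇒∈-≡ _ _ (map-≡⇒∈-≡ _ _ (cong proj₂ codes≡) q∈spine) y∈N[q]

  length-allCodes : (suc a ^ suc a) ^ k * length allCodes ≤ n * (M ^ suc a) ^ k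
  length-allCodes = subst₂ (λ l m → (suc a ^ suc a) ^ k * l ≤ m * (M ^ suc a) ^ k)
    (sym (length-concatMap _ (allFin n))) (length-tabulate {n = n} (λ i → i))
    (*-sum-map-≤ _ {(suc a ^ suc a) ^ k} (allFin n) codes-from)
    where
    r≡suc-a : length (spineShape G T spine) ≡ suc a
    r≡suc-a = trans (length-spineShape G T spine) (length-tabulate (lookup p))
    codes-from : ∀ v → (suc a ^ suc a) ^ k * length (map (v ,_) (codes G (spineShape G T spine) v M)) ≤ (M ^ suc a) ^ k
    codes-from v = subst₂ (λ l r → (r ^ r) ^ k * l ≤ (M ^ r) ^ k)
      (sym (length-map (v ,_) (codes G (spineShape G T spine) v M))) r≡suc-a
      (length-codes G k (spineShape G T spine) v M
        (spineShape-arity G T {k} (^degree≤^maxDegree (proj₁ (proj₂ tree)) maxDegree) spine))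

lemma2p11 : ∀ {n t : ℕ} (G : Graph n) (m : ℕ) → edgeCount G ≡ m →
    (T : Graph t) (a k : ℕ) → 1 ≤ a → IsCaterpillar T a → MaxDegree T k →
    (copies : List (Sub n)) → Unique copies → All (IsCopy G T) copies →
    length copies * a ^ (a * k) ≤ n * (2 * m) ^ (a * k)
lemma2p11 {n} G _ refl T (suc a) k (s≤s z≤n) (tree , p , p-injective , nonleaf⇔spine , spine-adj) maxDegree
          copies distinct are-copies = begin
  length copies * suc a ^ (suc a * k)     ≡⟨ *-comm (length copies) _ ⟩
  suc a ^ (suc a * k) * length copies     ≡⟨ cong (_* length copies) (^-*-assoc (suc a) (suc a) k) ⟨
  (suc a ^ suc a) ^ k * length copies     ≤⟨ *-monoʳ-≤ ((suc a ^ suc a) ^ k) copies≤codes ⟩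
  (suc a ^ suc a) ^ k * length allCodes   ≤⟨ length-allCodes ⟩
  n * (M ^ suc a) ^ k                     ≡⟨ cong (n *_) (^-*-assoc M (suc a) k) ⟩
  n * M ^ (suc a * k)                     ∎
  where
  open Encoding G tree p p-injective nonleaf⇔spine spine-adj maxDegree
  open ≤-Reasoning
  copies≤codes : length copies ≤ length allCodes
  copies≤codes = encoding⇒length≤ (λ {s} → code s) code-injective distinct are-copies (λ {s} → code∈allCodes s)
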